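{- Let $j>0$, $x\in\mathbb{Z}_{\ge0}$ and $y,z\in\mathbb{Z}_{\ge1}$ with $y\ne z$. Let $(a(n))_{n\ge1}$ be the $(j,x,y,z)$-hiccup sequence and put $b(n)=a(n)+j$. Then $(b(n))_{n\ge1}$ is the $(0,x+j,y,z)$-hiccup sequence.
   Context: For $j,x\in\mathbb{Z}_{\ge0}$ and $y,z\in\mathbb{Z}_{\ge1}$ with $y\ne z$, the $(j,x,y,z)$-hiccup sequence is the integer sequence $(a(n))_{n\ge1}$ defined by $a(1)=x$ and, for $n\ge 2$, $a(n)=a(n-1)+y$ if $n-j\in\{a(k):1\le k<n\}$, and $a(n)=a(n-1)+z$ otherwise. -}

module Defs where

open import Data.Nat using (ℕ; zero; suc; _+_; _∸_; _≤_; _≤?_; _≟_)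
open import Data.List using (List; []; _∷_; map; upTo)
open import Data.List.Membership.DecPropositional _≟_ using (_∈?_)
open import Relation.Nullary using (yes; no; _×-dec_)

-- Index convention: the paper's sequence (a(n))_{n≥1} is represented by
-- hiccupPrefix j x y z m = [a(m) , a(m-1) , … , a(1)] for m ≥ 1
-- (the list of the first m terms, most recent first), and
-- hiccup j x y z n = a(n) for n ≥ 1 (hiccup j x y z 0 is an unused junk value = x).

-- Step rule: a(n) = a(n-1) + y if n - j ∈ {a(k) : 1 ≤ k < n}, else a(n-1) + z.
-- Here n - j is an integer; since all a(k) ≥ 0, membership can only hold
-- when j ≤ n, in which case n - j = n ∸ j.
hiccupPrefix : ℕ → ℕ → ℕ → ℕ → ℕ → List ℕ
hiccupPrefix j x y z zero = []
hiccupPrefix j x y z (suc zero) = x ∷ []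
hiccupPrefix j x y z (suc (suc m)) with hiccupPrefix j x y z (suc m)
... | [] = []
... | prev@(last ∷ _) with (j ≤? suc (suc m)) ×-dec ((suc (suc m) ∸ j) ∈? prev)
...   | yes _ = (last + y) ∷ prev
...   | no _  = (last + z) ∷ prev

hiccup : ℕ → ℕ → ℕ → ℕ → ℕ → ℕ
hiccup j x y z n with hiccupPrefix j x y z n
... | [] = x
... | (v ∷ _) = v

module Submission where

-- Shifting every term by j turns the rule "a(n) - a(n-1) = y iff n - j is an
-- earlier term" into "b(n) - b(n-1) = y iff n is an earlier term", since
-- n ∈ {a(k) + j} exactly when j ≤ n and n - j ∈ {a(k)}.

open import Defs
open import Data.Nat using (ℕ; zero; suc; _+_; _∸_; _<_; _≤_; _≤?_; _≟_; z≤n)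
open import Data.Nat.Properties using (m+n∸n≡m; m≤n+m; m∸n+n≡m; +-commutativeSemigroup)
open import Algebra.Properties.CommutativeSemigroup +-commutativeSemigroup using (xy∙z≈xz∙y)
open import Data.List using (List; []; _∷_; map)
open import Data.List.Membership.DecPropositional _≟_ using (_∈?_)
open import Data.List.Membership.Propositional using (_∈_)
open import Data.List.Membership.Propositional.Properties using (∈-map⁺; ∈-map⁻)
open import Data.Product using (_×_; _,_)
open import Relation.Nullary using (yes; no; _×-dec_; contradiction)
open import Relation.Binary.PropositionalEquality
  using (_≡_; _≢_; refl; cong; subst; sym; module ≡-Reasoning)

hiccupStep : ℕ → ℕ → ℕ → ℕ → List ℕ → List ℕ
hiccupStep j y z n [] = []
hiccupStep j y z n prev@(last ∷ _) with (j ≤? n) ×-dec ((n ∸ j) ∈? prev)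
... | yes _ = (last + y) ∷ prev
... | no _  = (last + z) ∷ prev

hiccupPrefix-suc : ∀ j x y z m →
  hiccupPrefix j x y z (suc (suc m)) ≡ hiccupStep j y z (suc (suc m)) (hiccupPrefix j x y z (suc m))
hiccupPrefix-suc j x y z m with hiccupPrefix j x y z (suc m)
... | [] = refl
... | prev@(last ∷ _) with (j ≤? suc (suc m)) ×-dec ((suc (suc m) ∸ j) ∈? prev)
...   | yes _ = refl
...   | no _  = refl

∈-map-+⁻ : ∀ j n (L : List ℕ) → n ∈ map (_+ j) L → j ≤ n × n ∸ j ∈ L
∈-map-+⁻ j n L p with ∈-map⁻ (_+ j) p
... | a , a∈L , refl = m≤n+m j a , subst (_∈ L) (sym (m+n∸n≡m a j)) a∈L

∈-map-+⁺ : ∀ j n (L : List ℕ) → j ≤ n × n ∸ j ∈ L → n ∈ map (_+ j) L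
∈-map-+⁺ j n L (j≤n , p) = subst (_∈ map (_+ j) L) (m∸n+n≡m j≤n) (∈-map⁺ (_+ j) p)

hiccupStep-map-+ : ∀ j y z n L →
  hiccupStep 0 y z n (map (_+ j) L) ≡ map (_+ j) (hiccupStep j y z n L)
hiccupStep-map-+ j y z n [] = refl
hiccupStep-map-+ j y z n L@(l ∷ _)
  with (0 ≤? n) ×-dec (n ∈? map (_+ j) L) | (j ≤? n) ×-dec ((n ∸ j) ∈? L)
... | yes _       | yes _ = cong (_∷ map (_+ j) L) (xy∙z≈xz∙y l j y)
... | no _        | no _  = cong (_∷ map (_+ j) L) (xy∙z≈xz∙y l j z)
... | yes (_ , p) | no q  = contradiction (∈-map-+⁻ j n L p) q
... | no q        | yes p = contradiction (z≤n , ∈-map-+⁺ j n L p) q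

hiccupPrefix-shift : ∀ j x y z m →
  hiccupPrefix 0 (x + j) y z m ≡ map (_+ j) (hiccupPrefix j x y z m)
hiccupPrefix-shift j x y z zero = refl
hiccupPrefix-shift j x y z (suc zero) = refl
hiccupPrefix-shift j x y z (suc (suc m)) = begin
  hiccupPrefix 0 (x + j) y z (suc (suc m))
    ≡⟨ hiccupPrefix-suc 0 (x + j) y z m ⟩
  hiccupStep 0 y z (suc (suc m)) (hiccupPrefix 0 (x + j) y z (suc m))
    ≡⟨ cong (hiccupStep 0 y z (suc (suc m))) (hiccupPrefix-shift j x y z (suc m)) ⟩
  hiccupStep 0 y z (suc (suc m)) (map (_+ j) (hiccupPrefix j x y z (suc m)))
    ≡⟨ hiccupStep-map-+ j y z (suc (suc m)) (hiccupPrefix j x y z (suc m)) ⟩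
  map (_+ j) (hiccupStep j y z (suc (suc m)) (hiccupPrefix j x y z (suc m)))
    ≡⟨ cong (map (_+ j)) (sym (hiccupPrefix-suc j x y z m)) ⟩
  map (_+ j) (hiccupPrefix j x y z (suc (suc m))) ∎
  where open ≡-Reasoning

-- The identity holds for all j, y, z and n.
lemma9 : (j x y z : ℕ) → 0 < j → 1 ≤ y → 1 ≤ z → y ≢ z →
    (n : ℕ) → 1 ≤ n → hiccup j x y z n + j ≡ hiccup 0 (x + j) y z n
lemma9 j x y z _ _ _ _ n _ rewrite hiccupPrefix-shift j x y z n with hiccupPrefix j x y z n
... | []    = refl
... | _ ∷ _ = refl
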